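{- Let $(b|g;f_1,f_2)=(d_{n,k})_{n,k\ge0}$ be a double almost-Riordan array with $b(t)=\sum_{k\ge0}b_{2k}t^{2k}$, $g(t)=\sum_{k\ge0}g_{2k}t^{2k}$, $f_1(t)=\sum_{k\ge0}f_{1,2k+1}t^{2k+1}$, $f_2(t)=\sum_{k\ge0}f_{2,2k+1}t^{2k+1}$, and let its compression be $(\hat d_{n,k})_{n\ge k\ge0}$ with $\hat d_{n,k}=d_{2n-k,k}$. Put $\hat b(t)=\sum_kb_{2k}t^k$, $\hat g(t)=\sum_kg_{2k}t^k$, $\hat f_1(t)=\sum_kf_{1,2k+1}t^{k+1}$, $\hat f_2(t)=\sum_kf_{2,2k+1}t^{k+1}$. Then $\hat d_{n,0}=[t^n]\hat b(t)$, and for $k\ge1$ $$\hat d_{n,k}=\begin{cases}[t^n]\,t\hat g\,(\hat f_1\hat f_2)^{(k-1)/2}, & k \text{ odd},\\ [t^n]\,t\hat g\,\hat f_1(\hat f_1\hat f_2)^{(k-2)/2}, & k\text{ even}.\end{cases}$$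
   Context: Over a field of characteristic $0$, with $b_0,g_0,f_{1,1},f_{2,1}\neq0$, the double almost-Riordan array $(b|g;f_1,f_2)$ is the infinite lower triangular matrix $(d_{n,k})$ whose $k$-th column has generating function $b$ for $k=0$, $tg(f_1f_2)^{\ell}$ for $k=2\ell+1$, and $tgf_1(f_1f_2)^{\ell}$ for $k=2\ell+2$. -}

module Defs where

open import Level using (_⊔_)
open import Data.Nat as N using (ℕ; zero; suc; ⌊_/2⌋)
open import Data.Bool using (Bool; true; false; if_then_else_)
open import Data.Product using (∃; _,_)
open import Relation.Nullary using (¬_)
open import Relation.Binary.PropositionalEquality using (_≡_)
open import Algebra.Bundles using (CommutativeRing)

natElt : ∀ {c ℓ} (R : CommutativeRing c ℓ) → ℕ → CommutativeRing.Carrier R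
natElt R zero = CommutativeRing.0# R
natElt R (suc n) = CommutativeRing._+_ R (CommutativeRing.1# R) (natElt R n)

record Field0 c ℓ : Set (Level.suc (c ⊔ ℓ)) where
  field
    commutativeRing : CommutativeRing c ℓ
  open CommutativeRing commutativeRing public
  field
    1≉0     : ¬ (1# ≈ 0#)
    inverse : ∀ x → ¬ (x ≈ 0#) → ∃ λ y → x * y ≈ 1#
    char0   : ∀ n → ¬ (natElt commutativeRing (suc n) ≈ 0#)

module PowerSeries {c ℓ} (R : CommutativeRing c ℓ) where
  open CommutativeRing R

  PS : Set c
  PS = ℕ → Carrier

  coeff : ℕ → PS → Carrier
  coeff n a = a n

  sumBelow : ℕ → (ℕ → Carrier) → Carrier
  sumBelow zero f = 0#
  sumBelow (suc m) f = sumBelow m f + f m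

  _⊛_ : PS → PS → PS
  (a ⊛ b) n = sumBelow (suc n) (λ i → a i * b (n N.∸ i))
  infixl 7 _⊛_

  oneS : PS
  oneS zero = 1#
  oneS (suc n) = 0#

  _^S_ : PS → ℕ → PS
  a ^S zero = oneS
  a ^S suc k = a ⊛ (a ^S k)

  tS : PS → PS
  tS a zero = 0#
  tS a (suc n) = a n

  isEven : ℕ → Bool
  isEven zero = true
  isEven (suc zero) = false
  isEven (suc (suc n)) = isEven n

  -- Column generating functions of the double almost-Riordan array (b|g;f1,f2):
  -- column 0 is b, column 2ℓ+1 is t g (f1 f2)^ℓ, column 2ℓ+2 is t g f1 (f1 f2)^ℓ.
  column : PS → PS → PS → PS → ℕ → PS
  column b g f1 f2 zero = b
  column b g f1 f2 (suc k) =
    if isEven k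
      then tS (g ⊛ ((f1 ⊛ f2) ^S ⌊ k /2⌋))
      else tS (g ⊛ f1 ⊛ ((f1 ⊛ f2) ^S ⌊ k /2⌋))

  dar : PS → PS → PS → PS → ℕ → ℕ → Carrier
  dar b g f1 f2 n k = coeff n (column b g f1 f2 k)

  -- compression: \hat d_{n,k} = d_{2n-k,k} (meaningful for n ≥ k)
  compression : PS → PS → PS → PS → ℕ → ℕ → Carrier
  compression b g f1 f2 n k = dar b g f1 f2 (2 N.* n N.∸ k) k

  hatEven : PS → PS
  hatEven a k = a (2 N.* k)

  hatOdd : PS → PS
  hatOdd a zero = 0#
  hatOdd a (suc k) = a (suc (2 N.* k))

-- Even and odd series are substitutions t ↦ t²: b = b̂(t²), g = ĝ(t²), fᵢ = t·φᵢ(t²) with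
-- f̂ᵢ = t·φᵢ. Since a ↦ a(t²) is a ring homomorphism, column 2m+1 is t·(ĝ·E^m)(t²) and
-- column 2m+2 is t²·(ĝ·φ₁·E^m)(t²), where E = t·φ₁·φ₂ satisfies f₁f₂ = E(t²) and
-- f̂₁f̂₂ = t·E. Reading off the coefficient of t^(2n−k) in column k therefore gives the
-- coefficient of t^n in the claimed series, whose extra factor t^m comes from (t·E)^m.
module Submission where

open import Defs
open import Data.Nat as N using (ℕ; zero; suc; _≤_; _<_)
open import Data.Nat.Properties
  using (*-suc; m+n∸m≡n; m≤n⇒∃[o]m+o≡n; +-∸-assoc; n∸n≡0; ≤-pred; ≤-refl; m≤n⇒m≤1+n)
open import Data.Nat.Solver using (module +-*-Solver)
open import Data.Bool using (true; false)
open import Data.Product using (_×_; _,_)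
open import Relation.Nullary using (¬_)
open import Relation.Binary.Bundles using (Setoid)
import Relation.Binary.Reasoning.Setoid as SetoidReasoning
open import Relation.Binary.PropositionalEquality as ≡ using (_≡_)
open import Algebra.Bundles using (CommutativeRing)

data Parity : ℕ → Set where
  even : ∀ j → Parity (2 N.* j)
  odd  : ∀ j → Parity (suc (2 N.* j))

parity : ∀ n → Parity n
parity zero = even 0
parity (suc n) with parity n
... | even j = odd j
... | odd j  = ≡.subst Parity (*-suc 2 j) (even (suc j))

⌊2*m/2⌋≡m : ∀ m → N.⌊ 2 N.* m /2⌋ ≡ m
⌊2*m/2⌋≡m zero    = ≡.refl
⌊2*m/2⌋≡m (suc m) = ≡.trans (≡.cong N.⌊_/2⌋ (*-suc 2 m)) (≡.cong suc (⌊2*m/2⌋≡m m))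

⌊1+2*m/2⌋≡m : ∀ m → N.⌊ suc (2 N.* m) /2⌋ ≡ m
⌊1+2*m/2⌋≡m zero    = ≡.refl
⌊1+2*m/2⌋≡m (suc m) = ≡.trans (≡.cong (λ x → N.⌊ suc x /2⌋) (*-suc 2 m)) (≡.cong suc (⌊1+2*m/2⌋≡m m))

module _ where
  open +-*-Solver

  2*[k+r]∸k≡s+2*[m+r] : ∀ s m r → let k = s N.+ 2 N.* m in
                        2 N.* (k N.+ r) N.∸ k ≡ s N.+ 2 N.* (m N.+ r)
  2*[k+r]∸k≡s+2*[m+r] s m r =
    ≡.trans (≡.cong (N._∸ (s N.+ 2 N.* m)) double) (m+n∸m≡n (s N.+ 2 N.* m) (s N.+ 2 N.* (m N.+ r)))
    where
    double : 2 N.* ((s N.+ 2 N.* m) N.+ r) ≡ (s N.+ 2 N.* m) N.+ (s N.+ 2 N.* (m N.+ r))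
    double = solve 3 (λ s m r → con 2 :* ((s :+ con 2 :* m) :+ r)
                                 := (s :+ con 2 :* m) :+ (s :+ con 2 :* (m :+ r))) ≡.refl s m r

  s+2*m+r≡[s+m]+[m+r] : ∀ s m r → (s N.+ 2 N.* m) N.+ r ≡ (s N.+ m) N.+ (m N.+ r)
  s+2*m+r≡[s+m]+[m+r] = solve 3 (λ s m r → (s :+ con 2 :* m) :+ r := (s :+ m) :+ (m :+ r)) ≡.refl

module Series {c ℓ} (R : CommutativeRing c ℓ) where
  open CommutativeRing R hiding (zero)
  open PowerSeries R

  infix 4 _≋_
  _≋_ : PS → PS → Set ℓ
  a ≋ b = ∀ n → a n ≈ b n

  ≋-setoid : Setoid c ℓ
  ≋-setoid = record
    { Carrier       = PS
    ; _≈_           = _≋_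
    ; isEquivalence = record
      { refl  = λ n → refl
      ; sym   = λ e n → sym (e n)
      ; trans = λ e f n → trans (e n) (f n)
      }
    }

  open Setoid ≋-setoid using () renaming (refl to ≋-refl; reflexive to ≋-reflexive; sym to ≋-sym; trans to ≋-trans)
  module ≋-Reasoning = SetoidReasoning ≋-setoid
  module ≈-Reasoning = SetoidReasoning setoid

  sumBelow-cong : ∀ m {f f′} → (∀ i → i < m → f i ≈ f′ i) → sumBelow m f ≈ sumBelow m f′
  sumBelow-cong zero    e = refl
  sumBelow-cong (suc m) e = +-cong (sumBelow-cong m (λ i i<m → e i (m≤n⇒m≤1+n i<m))) (e m ≤-refl)

  sumBelow-suc : ∀ n f → sumBelow (suc n) f ≈ f 0 + sumBelow n (λ i → f (suc i))
  sumBelow-suc zero    f = +-comm 0# (f 0)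
  sumBelow-suc (suc n) f = trans (+-cong (sumBelow-suc n f) refl) (+-assoc _ _ _)

  ⊛-cong : ∀ {a a′ b b′} → a ≋ a′ → b ≋ b′ → a ⊛ b ≋ a′ ⊛ b′
  ⊛-cong ea eb n = sumBelow-cong (suc n) (λ i _ → *-cong (ea i) (eb _))

  ^S-cong : ∀ {a a′} m → a ≋ a′ → a ^S m ≋ a′ ^S m
  ^S-cong zero    e = ≋-refl
  ^S-cong (suc m) e = ⊛-cong e (^S-cong m e)

  tS-cong : ∀ {a a′} → a ≋ a′ → tS a ≋ tS a′
  tS-cong e zero    = refl
  tS-cong e (suc n) = e n

  ⊛-suc : ∀ a b n → (a ⊛ b) (suc n) ≈ a 0 * b (suc n) + ((λ i → a (suc i)) ⊛ b) n
  ⊛-suc a b n = sumBelow-suc (suc n) (λ i → a i * b (suc n N.∸ i))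

  tS-⊛ : ∀ a b → tS a ⊛ b ≋ tS (a ⊛ b)
  tS-⊛ a b zero    = trans (+-identityˡ _) (zeroˡ (b 0))
  tS-⊛ a b (suc n) = trans (⊛-suc (tS a) b n) (trans (+-cong (zeroˡ _) refl) (+-identityˡ _))

  ⊛-tS : ∀ a b → a ⊛ tS b ≋ tS (a ⊛ b)
  ⊛-tS a b zero    = trans (+-identityˡ _) (zeroʳ (a 0))
  ⊛-tS a b (suc n) = trans (+-cong shifted last) (+-identityʳ _)
    where
    shifted : sumBelow (suc n) (λ i → a i * tS b (suc n N.∸ i)) ≈ sumBelow (suc n) (λ i → a i * b (n N.∸ i))
    shifted = sumBelow-cong (suc n) (λ i i≤n → *-cong refl (reflexive (≡.cong (tS b) (+-∸-assoc 1 (≤-pred i≤n)))))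
    last : a (suc n) * tS b (n N.∸ n) ≈ 0#
    last = trans (*-cong refl (reflexive (≡.cong (tS b) (n∸n≡0 n)))) (zeroʳ _)

  tSⁿ : ℕ → PS → PS
  tSⁿ zero    a = a
  tSⁿ (suc m) a = tS (tSⁿ m a)

  tSⁿ-coeff : ∀ m a j → tSⁿ m a (m N.+ j) ≡ a j
  tSⁿ-coeff zero    a j = ≡.refl
  tSⁿ-coeff (suc m) a j = tSⁿ-coeff m a j

  tSⁿ-cong : ∀ m {a a′} → a ≋ a′ → tSⁿ m a ≋ tSⁿ m a′
  tSⁿ-cong zero    e = e
  tSⁿ-cong (suc m) e = tS-cong (tSⁿ-cong m e)

  tSⁿ-⊛-tSⁿ : ∀ k m a b → tSⁿ k a ⊛ tSⁿ m b ≋ tSⁿ (k N.+ m) (a ⊛ b)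
  tSⁿ-⊛-tSⁿ zero    zero    a b = ≋-refl
  tSⁿ-⊛-tSⁿ zero    (suc m) a b = ≋-trans (⊛-tS a (tSⁿ m b)) (tS-cong (tSⁿ-⊛-tSⁿ 0 m a b))
  tSⁿ-⊛-tSⁿ (suc k) m       a b = ≋-trans (tS-⊛ (tSⁿ k a) (tSⁿ m b)) (tS-cong (tSⁿ-⊛-tSⁿ k m a b))

  tS-^S : ∀ a m → tS a ^S m ≋ tSⁿ m (a ^S m)
  tS-^S a zero    = ≋-refl
  tS-^S a (suc m) = ≋-trans (⊛-cong ≋-refl (tS-^S a m)) (tSⁿ-⊛-tSⁿ 1 m a (a ^S m))

  -- dilate a = a(t²)
  dilate : PS → PS
  dilate a zero          = a zero
  dilate a (suc zero)    = 0#
  dilate a (suc (suc n)) = dilate (λ i → a (suc i)) n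

  dilate-even : ∀ a j → dilate a (2 N.* j) ≡ a j
  dilate-even a zero    = ≡.refl
  dilate-even a (suc j) = ≡.trans (≡.cong (dilate a) (*-suc 2 j)) (dilate-even (λ i → a (suc i)) j)

  dilate-odd : ∀ a j → dilate a (suc (2 N.* j)) ≡ 0#
  dilate-odd a zero    = ≡.refl
  dilate-odd a (suc j) = ≡.trans (≡.cong (λ x → dilate a (suc x)) (*-suc 2 j)) (dilate-odd (λ i → a (suc i)) j)

  dilate-cong : ∀ {a a′} → a ≋ a′ → dilate a ≋ dilate a′
  dilate-cong e zero          = e 0
  dilate-cong e (suc zero)    = refl
  dilate-cong e (suc (suc n)) = dilate-cong (λ i → e (suc i)) n

  dilate-tS : ∀ a → dilate (tS a) ≋ tSⁿ 2 (dilate a)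
  dilate-tS a zero          = refl
  dilate-tS a (suc zero)    = refl
  dilate-tS a (suc (suc n)) = refl

  dilate-oneS : dilate oneS ≋ oneS
  dilate-oneS zero          = refl
  dilate-oneS (suc zero)    = refl
  dilate-oneS (suc (suc n)) = reflexive (dilate-0 n)
    where
    dilate-0 : ∀ n → dilate (λ _ → 0#) n ≡ 0#
    dilate-0 zero          = ≡.refl
    dilate-0 (suc zero)    = ≡.refl
    dilate-0 (suc (suc n)) = dilate-0 n

  dilate-linear : ∀ x a b n → dilate (λ i → x * a i + b i) n ≈ x * dilate a n + dilate b n
  dilate-linear x a b zero          = refl
  dilate-linear x a b (suc zero)    = sym (trans (+-identityʳ _) (zeroʳ x))
  dilate-linear x a b (suc (suc n)) = dilate-linear x (λ i → a (suc i)) (λ i → b (suc i)) n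

  -- Writing a = a 0 + t·a′, the claim for a at 2+n reduces to the claim for a′ at n.
  dilate-⊛ : ∀ a b → dilate (a ⊛ b) ≋ dilate a ⊛ dilate b
  dilate-⊛ a b zero          = refl
  dilate-⊛ a b (suc zero)    = sym (trans (+-cong (trans (+-identityˡ _) (zeroʳ _)) (zeroˡ _)) (+-identityˡ _))
  dilate-⊛ a b (suc (suc n)) = begin
    dilate (λ i → (a ⊛ b) (suc i)) n
      ≈⟨ dilate-cong (⊛-suc a b) n ⟩
    dilate (λ i → a 0 * b (suc i) + (a′ ⊛ b) i) n
      ≈⟨ dilate-linear (a 0) (λ i → b (suc i)) (a′ ⊛ b) n ⟩
    a 0 * dilate b (2 N.+ n) + dilate (a′ ⊛ b) n
      ≈⟨ +-cong refl (dilate-⊛ a′ b n) ⟩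
    a 0 * dilate b (2 N.+ n) + (dilate a′ ⊛ dilate b) n
      ≈⟨ +-cong refl (tS-⊛ (dilate a′) (dilate b) (suc n)) ⟨
    a 0 * dilate b (2 N.+ n) + (tS (dilate a′) ⊛ dilate b) (suc n)
      ≈⟨ +-cong refl (⊛-cong dilate-tail (≋-refl {dilate b}) (suc n)) ⟨
    a 0 * dilate b (2 N.+ n) + ((λ i → dilate a (suc i)) ⊛ dilate b) (suc n)
      ≈⟨ ⊛-suc (dilate a) (dilate b) (suc n) ⟨
    (dilate a ⊛ dilate b) (2 N.+ n)
      ∎
    where
    open ≈-Reasoning
    a′ : PS
    a′ i = a (suc i)
    dilate-tail : (λ i → dilate a (suc i)) ≋ tS (dilate a′)
    dilate-tail zero    = refl
    dilate-tail (suc i) = refl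

  dilate-^S : ∀ a m → dilate (a ^S m) ≋ dilate a ^S m
  dilate-^S a zero    = dilate-oneS
  dilate-^S a (suc m) = ≋-trans (dilate-⊛ a (a ^S m)) (⊛-cong ≋-refl (dilate-^S a m))

  oddPart : PS → PS
  oddPart a k = a (suc (2 N.* k))

  even-dilate : ∀ a → (∀ k → a (suc (2 N.* k)) ≈ 0#) → a ≋ dilate (hatEven a)
  even-dilate a a-even n with parity n
  ... | even j = sym (reflexive (dilate-even (hatEven a) j))
  ... | odd j  = trans (a-even j) (sym (reflexive (dilate-odd (hatEven a) j)))

  odd-tS-dilate : ∀ a → (∀ k → a (2 N.* k) ≈ 0#) → a ≋ tS (dilate (oddPart a))
  odd-tS-dilate a a-odd zero = a-odd 0
  odd-tS-dilate a a-odd (suc n) with parity n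
  ... | even j = sym (reflexive (dilate-even (oddPart a) j))
  ... | odd j  = trans (trans (reflexive (≡.cong a (≡.sym (*-suc 2 j)))) (a-odd (suc j)))
                       (sym (reflexive (dilate-odd (oddPart a) j)))

  hatOdd≋tS-oddPart : ∀ a → hatOdd a ≋ tS (oddPart a)
  hatOdd≋tS-oddPart a zero    = refl
  hatOdd≋tS-oddPart a (suc n) = refl

  -- Writing n = k + r, both sides are the coefficient X (m + r).
  compression-coeff : ∀ s m {C T : PS} (X : PS) → C ≋ tSⁿ s (dilate X) → T ≋ tSⁿ (s N.+ m) X →
                      ∀ n → s N.+ 2 N.* m ≤ n → C (2 N.* n N.∸ (s N.+ 2 N.* m)) ≈ T n
  compression-coeff s m {C} {T} X C≋ T≋ n k≤n with m≤n⇒∃[o]m+o≡n k≤n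
  ... | r , ≡.refl = begin
    C (2 N.* (k N.+ r) N.∸ k)                  ≡⟨ ≡.cong C (2*[k+r]∸k≡s+2*[m+r] s m r) ⟩
    C (s N.+ 2 N.* (m N.+ r))                  ≈⟨ C≋ _ ⟩
    tSⁿ s (dilate X) (s N.+ 2 N.* (m N.+ r))   ≡⟨ tSⁿ-coeff s (dilate X) _ ⟩
    dilate X (2 N.* (m N.+ r))                 ≡⟨ dilate-even X (m N.+ r) ⟩
    X (m N.+ r)                                ≡⟨ tSⁿ-coeff (s N.+ m) X (m N.+ r) ⟨
    tSⁿ (s N.+ m) X ((s N.+ m) N.+ (m N.+ r))  ≡⟨ ≡.cong (tSⁿ (s N.+ m) X) (s+2*m+r≡[s+m]+[m+r] s m r) ⟨
    tSⁿ (s N.+ m) X (k N.+ r)                  ≈⟨ T≋ _ ⟨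
    T (k N.+ r)                                ∎
    where
    open ≈-Reasoning
    k = s N.+ 2 N.* m

  isEven-2*m : ∀ m → isEven (2 N.* m) ≡ true
  isEven-2*m zero    = ≡.refl
  isEven-2*m (suc m) = ≡.trans (≡.cong isEven (*-suc 2 m)) (isEven-2*m m)

  isEven-1+2*m : ∀ m → isEven (suc (2 N.* m)) ≡ false
  isEven-1+2*m zero    = ≡.refl
  isEven-1+2*m (suc m) = ≡.trans (≡.cong (λ x → isEven (suc x)) (*-suc 2 m)) (isEven-1+2*m m)

  column-odd : ∀ b g f1 f2 m → column b g f1 f2 (suc (2 N.* m)) ≡ tS (g ⊛ (f1 ⊛ f2) ^S m)
  column-odd b g f1 f2 m rewrite isEven-2*m m | ⌊2*m/2⌋≡m m = ≡.refl

  column-even : ∀ b g f1 f2 m → column b g f1 f2 (2 N.+ 2 N.* m) ≡ tS (g ⊛ f1 ⊛ (f1 ⊛ f2) ^S m)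
  column-even b g f1 f2 m rewrite isEven-1+2*m m | ⌊1+2*m/2⌋≡m m = ≡.refl

  module _ (g f1 f2 : PS)
           (g-even : ∀ k → g (suc (2 N.* k)) ≈ 0#)
           (f1-odd : ∀ k → f1 (2 N.* k) ≈ 0#)
           (f2-odd : ∀ k → f2 (2 N.* k) ≈ 0#) where

    private
      ĝ φ₁ φ₂ E : PS
      ĝ  = hatEven g
      φ₁ = oddPart f1
      φ₂ = oddPart f2
      E  = tS (φ₁ ⊛ φ₂)

    f1⊛f2≋dilate-E : f1 ⊛ f2 ≋ dilate E
    f1⊛f2≋dilate-E = begin
      f1 ⊛ f2                          ≈⟨ ⊛-cong (odd-tS-dilate f1 f1-odd) (odd-tS-dilate f2 f2-odd) ⟩
      tS (dilate φ₁) ⊛ tS (dilate φ₂)  ≈⟨ tSⁿ-⊛-tSⁿ 1 1 (dilate φ₁) (dilate φ₂) ⟩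
      tSⁿ 2 (dilate φ₁ ⊛ dilate φ₂)    ≈⟨ tSⁿ-cong 2 (dilate-⊛ φ₁ φ₂) ⟨
      tSⁿ 2 (dilate (φ₁ ⊛ φ₂))         ≈⟨ dilate-tS (φ₁ ⊛ φ₂) ⟨
      dilate E                         ∎
      where open ≋-Reasoning

    hatOdd⊛hatOdd≋tS-E : hatOdd f1 ⊛ hatOdd f2 ≋ tS E
    hatOdd⊛hatOdd≋tS-E = ≋-trans (⊛-cong (hatOdd≋tS-oddPart f1) (hatOdd≋tS-oddPart f2)) (tSⁿ-⊛-tSⁿ 1 1 φ₁ φ₂)

    column-odd-dilate : ∀ m → tS (g ⊛ (f1 ⊛ f2) ^S m) ≋ tSⁿ 1 (dilate (ĝ ⊛ E ^S m))
    column-odd-dilate m = tS-cong (begin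
      g ⊛ (f1 ⊛ f2) ^S m           ≈⟨ ⊛-cong (even-dilate g g-even) (^S-cong m f1⊛f2≋dilate-E) ⟩
      dilate ĝ ⊛ dilate E ^S m     ≈⟨ ⊛-cong (≋-refl {dilate ĝ}) (dilate-^S E m) ⟨
      dilate ĝ ⊛ dilate (E ^S m)   ≈⟨ dilate-⊛ ĝ (E ^S m) ⟨
      dilate (ĝ ⊛ E ^S m)          ∎)
      where open ≋-Reasoning

    column-even-dilate : ∀ m → tS (g ⊛ f1 ⊛ (f1 ⊛ f2) ^S m) ≋ tSⁿ 2 (dilate (ĝ ⊛ φ₁ ⊛ E ^S m))
    column-even-dilate m = tS-cong (begin
      g ⊛ f1 ⊛ (f1 ⊛ f2) ^S m
        ≈⟨ ⊛-cong (⊛-cong (even-dilate g g-even) (odd-tS-dilate f1 f1-odd)) (^S-cong m f1⊛f2≋dilate-E) ⟩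
      dilate ĝ ⊛ tS (dilate φ₁) ⊛ dilate E ^S m
        ≈⟨ ⊛-cong (⊛-tS (dilate ĝ) (dilate φ₁)) (≋-sym (dilate-^S E m)) ⟩
      tS (dilate ĝ ⊛ dilate φ₁) ⊛ dilate (E ^S m)
        ≈⟨ tS-⊛ (dilate ĝ ⊛ dilate φ₁) (dilate (E ^S m)) ⟩
      tS (dilate ĝ ⊛ dilate φ₁ ⊛ dilate (E ^S m))
        ≈⟨ tS-cong (⊛-cong (dilate-⊛ ĝ φ₁) (≋-refl {dilate (E ^S m)})) ⟨
      tS (dilate (ĝ ⊛ φ₁) ⊛ dilate (E ^S m))
        ≈⟨ tS-cong (dilate-⊛ (ĝ ⊛ φ₁) (E ^S m)) ⟨
      tS (dilate (ĝ ⊛ φ₁ ⊛ E ^S m))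
        ∎)
      where open ≋-Reasoning

    hatOdd-power : ∀ m → (hatOdd f1 ⊛ hatOdd f2) ^S m ≋ tSⁿ m (E ^S m)
    hatOdd-power m = ≋-trans (^S-cong m hatOdd⊛hatOdd≋tS-E) (tS-^S E m)

    odd-target : ∀ m → tS (ĝ ⊛ (hatOdd f1 ⊛ hatOdd f2) ^S m) ≋ tSⁿ (1 N.+ m) (ĝ ⊛ E ^S m)
    odd-target m = tS-cong (≋-trans (⊛-cong (≋-refl {ĝ}) (hatOdd-power m)) (tSⁿ-⊛-tSⁿ 0 m ĝ (E ^S m)))

    even-target : ∀ m → tS (ĝ ⊛ hatOdd f1 ⊛ (hatOdd f1 ⊛ hatOdd f2) ^S m) ≋ tSⁿ (2 N.+ m) (ĝ ⊛ φ₁ ⊛ E ^S m)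
    even-target m = tS-cong (begin
      ĝ ⊛ hatOdd f1 ⊛ (hatOdd f1 ⊛ hatOdd f2) ^S m
        ≈⟨ ⊛-cong (⊛-cong (≋-refl {ĝ}) (hatOdd≋tS-oddPart f1)) (hatOdd-power m) ⟩
      ĝ ⊛ tS φ₁ ⊛ tSⁿ m (E ^S m)
        ≈⟨ ⊛-cong (⊛-tS ĝ φ₁) (≋-refl {tSⁿ m (E ^S m)}) ⟩
      tS (ĝ ⊛ φ₁) ⊛ tSⁿ m (E ^S m)
        ≈⟨ tSⁿ-⊛-tSⁿ 1 m (ĝ ⊛ φ₁) (E ^S m) ⟩
      tSⁿ (1 N.+ m) (ĝ ⊛ φ₁ ⊛ E ^S m)
        ∎)
      where open ≋-Reasoning

    compression-odd : ∀ b n m → suc (2 N.* m) ≤ n →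
      compression b g f1 f2 n (suc (2 N.* m)) ≈ coeff n (tS (ĝ ⊛ (hatOdd f1 ⊛ hatOdd f2) ^S m))
    compression-odd b n m = compression-coeff 1 m (ĝ ⊛ E ^S m)
      (≋-trans (≋-reflexive (column-odd b g f1 f2 m)) (column-odd-dilate m)) (odd-target m) n

    compression-even : ∀ b n m → 2 N.+ 2 N.* m ≤ n →
      compression b g f1 f2 n (2 N.+ 2 N.* m) ≈ coeff n (tS (ĝ ⊛ hatOdd f1 ⊛ (hatOdd f1 ⊛ hatOdd f2) ^S m))
    compression-even b n m = compression-coeff 2 m (ĝ ⊛ φ₁ ⊛ E ^S m)
      (≋-trans (≋-reflexive (column-even b g f1 f2 m)) (column-even-dilate m)) (even-target m) n

theorem4p1 : ∀ {c ℓ} (F : Field0 c ℓ) →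
    let open Field0 F in
    let open PowerSeries commutativeRing in
    (b g f1 f2 : PS) →
    ¬ (b 0 ≈ 0#) → ¬ (g 0 ≈ 0#) → ¬ (f1 1 ≈ 0#) → ¬ (f2 1 ≈ 0#) →
    (∀ k → b (suc (2 N.* k)) ≈ 0#) →
    (∀ k → g (suc (2 N.* k)) ≈ 0#) →
    (∀ k → f1 (2 N.* k) ≈ 0#) →
    (∀ k → f2 (2 N.* k) ≈ 0#) →
    (∀ n → compression b g f1 f2 n 0 ≈ coeff n (hatEven b))
    × (∀ n m → suc (2 N.* m) N.≤ n →
         compression b g f1 f2 n (suc (2 N.* m))
           ≈ coeff n (tS (hatEven g ⊛ ((hatOdd f1 ⊛ hatOdd f2) ^S m))))
    × (∀ n m → 2 N.+ 2 N.* m N.≤ n →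
         compression b g f1 f2 n (2 N.+ 2 N.* m)
           ≈ coeff n (tS (hatEven g ⊛ hatOdd f1 ⊛ ((hatOdd f1 ⊛ hatOdd f2) ^S m))))
theorem4p1 F b g f1 f2 _ _ _ _ _ g-even f1-odd f2-odd =
    (λ n → refl)
  , compression-odd g f1 f2 g-even f1-odd f2-odd b
  , compression-even g f1 f2 g-even f1-odd f2-odd b
  where open Field0 F using (commutativeRing; refl)
        open Series commutativeRing
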